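{- Let $p$ be an odd prime, let $k,q$ be positive integers with $p \nmid q$, and write $\mathrm{ord}_{p^k}(q) = p^i d$ with $i,d$ nonnegative integers and $d \mid p-1$. If $i>0$, then $\mathrm{ord}_{p^{k-1}}(q) = p^{i-1}d$ and $m(q,p^k) = m(q,p^{k-1})$.
   Context: $\mathrm{ord}_e(q)$ denotes the multiplicative order of $q$ modulo $e$. For coprime positive integers $q,e$, $m(q,e)$ denotes the least positive integer $t$ such that there exist nonnegative integers $a_1,\ldots,a_t$ (repetitions allowed) with $q^{a_1}+\cdots+q^{a_t} \equiv 0 \pmod e$. -}

module Defs where

open import Data.Nat using (ℕ; zero; suc; _+_; _*_; _∸_; _^_; _≤_; _<_)
open import Data.Nat.Divisibility using (_∣_)
open import Data.List using (List; length; map)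
open import Data.Nat.ListAction using (sum)
open import Relation.Binary.PropositionalEquality using (_≡_)
open import Data.Product using (_×_; ∃-syntax)

-- n is the multiplicative order of q modulo e:
-- n ≥ 1, q^n ≡ 1 (mod e), and n is least with this property.
-- (Used with q ≥ 1, so q ^ n ∸ 1 is the true difference q^n - 1.)
IsOrd : ℕ → ℕ → ℕ → Set
IsOrd e q n =
  0 < n × e ∣ (q ^ n ∸ 1) × (∀ n′ → 0 < n′ → e ∣ (q ^ n′ ∸ 1) → n ≤ n′)

SumRep : ℕ → ℕ → ℕ → Set
SumRep e q t = ∃[ as ] (length as ≡ t × e ∣ sum (map (q ^_) as))

IsM : ℕ → ℕ → ℕ → Set
IsM e q t = 0 < t × SumRep e q t × (∀ t′ → 0 < t′ → SumRep e q t′ → t ≤ t′)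

{-# OPTIONS --safe #-}

-- Let r p be the order of q modulo p^(k+1) and x = q^r. Fermat's little theorem turns
-- p^(k+1) ∣ x^p − 1 into p ∣ x − 1, and for odd p the lifting-the-exponent step
-- x^p − 1 = (x − 1) · p · (1 + p t) shows that p^k divides x − 1 exactly; this gives
-- ord_{p^k}(q) = r. For m, a representation of 0 modulo p^k by t powers of q becomes one
-- modulo p^(k+1) by replacing one summand q^a by q^(a + r j) = q^a x^j ≡ q^a (1 + j (x − 1))
-- modulo p^(2k), with j chosen to cancel the next p-adic digit; the converse is trivial.
module Submission where

open import Data.Nat
open import Data.Nat.Properties
open import Data.Nat.Divisibility
open import Data.Nat.DivMod using (m/n*n≡m; m≡m%n+[m/n]*n; m%n<n)
open import Data.Nat.Primality using (Prime; euclidsLemma; prime⇒irreducible; prime⇒nonZero; prime⇒nonTrivial; ¬prime[1])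
open import Data.Nat.Combinatorics using (_C_; nCn≡1; k![n∸k]!∣n!)
open import Data.Nat.Combinatorics.Specification using (nCk≡n!/k![n-k]!)
open import Data.Nat.ListAction using () renaming (sum to sumˡ)
open import Data.Nat.Tactic.RingSolver using (solve-∀)
open import Data.Fin.Base using (Fin; zero; suc; toℕ; inject₁; fromℕ)
open import Data.Fin.Properties using (toℕ<n; toℕ-inject₁; toℕ-fromℕ)
open import Data.List.Base using ([]; _∷_; map)
open import Data.Vec.Functional using (Vector)
open import Data.Product.Base using (∃; _×_; _,_; proj₁; proj₂)
open import Data.Sum.Base using (inj₁; inj₂)
open import Function.Bundles using (_⇔_; mk⇔; Equivalence)
open import Relation.Binary.PropositionalEquality
open import Relation.Nullary.Negation using (¬_; contradiction)
import Algebra.Definitions.RawMonoid as RawMonoid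
import Algebra.Definitions.RawSemiring as RawSemiring
open import Algebra.Properties.CommutativeSemiring.Binomial +-*-commutativeSemiring using (theorem)
open import Algebra.Properties.Semiring.Sum +-*-semiring using (sum; sum-init-last)

open import Defs

open ≡-Reasoning

×≡* : ∀ m n → RawMonoid._×_ +-0-rawMonoid m n ≡ m * n
×≡* zero    n = refl
×≡* (suc m) n = cong (n +_) (×≡* m n)

^ᴬ≡^ : ∀ m n → RawSemiring._^_ +-*-rawSemiring m n ≡ m ^ n
^ᴬ≡^ m zero    = refl
^ᴬ≡^ m (suc n) = cong (m *_) (^ᴬ≡^ m n)

∣-sum : ∀ {d n} (f : Vector ℕ n) → (∀ i → d ∣ f i) → d ∣ sum f
∣-sum {n = zero}  f d∣f = _ ∣0
∣-sum {n = suc n} f d∣f = ∣m∣n⇒∣m+n (d∣f zero) (∣-sum (λ i → f (suc i)) (λ i → d∣f (suc i)))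

p∤1 : ∀ {p} → Prime p → p ∤ 1
p∤1 pr p∣1 = ¬prime[1] (subst Prime (∣1⇒≡1 p∣1) pr)

p∤m! : ∀ {p m} → Prime p → m < p → p ∤ m !
p∤m! {m = zero}  pr _ = p∤1 pr
p∤m! {m = suc m} pr m<p p∣m! with euclidsLemma (suc m) (m !) pr p∣m!
... | inj₁ p∣m = <⇒≱ m<p (∣⇒≤ p∣m)
... | inj₂ p∣m! = p∤m! pr (<-trans (n<1+n m) m<p) p∣m!

p∣pCk : ∀ {p k} → Prime p → 0 < k → k < p → p ∣ p C k
p∣pCk {p@(suc p-1)} {k} pr 0<k k<p with euclidsLemma (p C k) (k ! * (p ∸ k) !) pr p∣C*D
  where
  instance _ = k !* (p ∸ k) !≢0
  p∣C*D : p ∣ (p C k) * (k ! * (p ∸ k) !)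
  p∣C*D = subst (p ∣_) (sym (trans (cong (_* (k ! * (p ∸ k) !)) (nCk≡n!/k![n-k]! (<⇒≤ k<p)))
                                   (m/n*n≡m (k![n∸k]!∣n! (<⇒≤ k<p)))))
                (m∣m*n (p-1 !))
... | inj₁ p∣C = p∣C
... | inj₂ p∣D with euclidsLemma (k !) ((p ∸ k) !) pr p∣D
...   | inj₁ p∣k! = contradiction p∣k! (p∤m! pr k<p)
...   | inj₂ p∣r! = contradiction p∣r! (p∤m! pr (∸-monoʳ-< 0<k (<⇒≤ k<p)))

freshman's-dream : ∀ {p} → Prime p → ∀ x → ∃ λ c → (x + 1) ^ p ≡ x ^ p + 1 + p * c
freshman's-dream {p@(suc (suc m))} pr x = quotient p∣middle , (begin
  (x + 1) ^ p                                ≡⟨ ^ᴬ≡^ (x + 1) p ⟨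
  (x + 1) ^ᴬ p                               ≡⟨ theorem p x 1 ⟩
  sum term                                   ≡⟨ cong (term zero +_) (sum-init-last (λ k → term (suc k))) ⟩
  term zero + (sum middle + term (fromℕ p))  ≡⟨ cong₂ (λ a b → a + (sum middle + b)) term₀ termₚ ⟩
  1 + (sum middle + x ^ p)                   ≡⟨ cong (λ s → 1 + (s + x ^ p)) (m∣n⇒n≡m*quotient p∣middle) ⟩
  1 + (p * quotient p∣middle + x ^ p)        ≡⟨ rearrange (p * quotient p∣middle) (x ^ p) ⟩
  x ^ p + 1 + p * quotient p∣middle          ∎)
  where
  _^ᴬ_ = RawSemiring._^_ +-*-rawSemiring
  term : Fin (suc p) → ℕ
  term k = RawMonoid._×_ +-0-rawMonoid (p C toℕ k) (x ^ᴬ toℕ k * 1 ^ᴬ (p ∸ toℕ k))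
  term≡ : ∀ k → term k ≡ (p C toℕ k) * (x ^ᴬ toℕ k * 1 ^ᴬ (p ∸ toℕ k))
  term≡ k = ×≡* (p C toℕ k) _
  middle : Fin (suc m) → ℕ
  middle j = term (suc (inject₁ j))
  p∣middle : p ∣ sum middle
  p∣middle = ∣-sum middle λ j → subst (p ∣_) (sym (term≡ (suc (inject₁ j))))
    (∣m⇒∣m*n _ (p∣pCk pr z<s (s≤s (subst (_< suc m) (sym (toℕ-inject₁ j)) (toℕ<n j)))))
  term₀ : term zero ≡ 1
  term₀ = begin
    term zero         ≡⟨ term≡ zero ⟩
    1 * (1 * 1 ^ᴬ p)  ≡⟨ cong (λ v → 1 * (1 * v)) (trans (^ᴬ≡^ 1 p) (^-zeroˡ p)) ⟩
    1                 ∎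
  termₚ : term (fromℕ p) ≡ x ^ p
  termₚ = begin
    term (fromℕ p)                     ≡⟨ term≡ (fromℕ p) ⟩
    (p C toℕ (fromℕ p)) * (x ^ᴬ toℕ (fromℕ p) * 1 ^ᴬ (p ∸ toℕ (fromℕ p)))
                                       ≡⟨ cong (λ k → (p C k) * (x ^ᴬ k * 1 ^ᴬ (p ∸ k))) (toℕ-fromℕ p) ⟩
    (p C p) * (x ^ᴬ p * 1 ^ᴬ (p ∸ p))  ≡⟨ cong₂ (λ c v → c * (v * 1 ^ᴬ (p ∸ p))) (nCn≡1 p) (^ᴬ≡^ x p) ⟩
    1 * (x ^ p * 1 ^ᴬ (p ∸ p))         ≡⟨ cong (λ k → 1 * (x ^ p * 1 ^ᴬ k)) (n∸n≡0 p) ⟩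
    1 * (x ^ p * 1)                    ≡⟨ trans (*-identityˡ _) (*-identityʳ _) ⟩
    x ^ p                              ∎
  rearrange : ∀ a b → 1 + (a + b) ≡ b + 1 + a
  rearrange = solve-∀

fermat : ∀ {p} → Prime p → ∀ x → ∃ λ c → x ^ p ≡ x + p * c
fermat {suc p-1} pr zero = 0 , sym (*-zeroʳ (suc p-1))
fermat {p} pr (suc x) with fermat pr x | freshman's-dream pr x
... | c , x^p≡ | c′ , [x+1]^p≡ = c + c′ , (begin
  suc x ^ p                ≡⟨ cong (_^ p) (+-comm 1 x) ⟩
  (x + 1) ^ p              ≡⟨ [x+1]^p≡ ⟩
  x ^ p + 1 + p * c′       ≡⟨ cong (λ v → v + 1 + p * c′) x^p≡ ⟩
  x + p * c + 1 + p * c′   ≡⟨ rearrange x p c c′ ⟩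
  suc x + p * (c + c′)     ∎)
  where
  rearrange : ∀ x p c c′ → x + p * c + 1 + p * c′ ≡ suc x + p * (c + c′)
  rearrange = solve-∀

prime≢2⇒odd : ∀ {p} → Prime p → p ≢ 2 → ∃ λ h → p ≡ 1 + 2 * h
prime≢2⇒odd {p} pr p≢2 with p % 2 | m≡m%n+[m/n]*n p 2 | m%n<n p 2
... | 0 | p≡ | _ with prime⇒irreducible pr (divides (p / 2) p≡)
...   | inj₂ 2≡p = contradiction (sym 2≡p) p≢2
prime≢2⇒odd {p} pr p≢2 | 1 | p≡ | _ = p / 2 , trans p≡ (cong suc (*-comm (p / 2) 2))
prime≢2⇒odd {p} pr p≢2 | 2+ _ | _ | s≤s (s≤s ())

triangular : ℕ → ℕ
triangular zero    = 0
triangular (suc n) = triangular n + n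

triangular-odd : ∀ h → triangular (1 + 2 * h) ≡ (1 + 2 * h) * h
triangular-odd zero = refl
triangular-odd (suc h) = begin
  triangular (1 + 2 * suc h)                           ≡⟨ cong (λ m → triangular (1 + m)) (*-suc 2 h) ⟩
  triangular (1 + 2 * h) + (1 + 2 * h) + (2 + 2 * h)   ≡⟨ cong (λ T → T + (1 + 2 * h) + (2 + 2 * h)) (triangular-odd h) ⟩
  (1 + 2 * h) * h + (1 + 2 * h) + (2 + 2 * h)          ≡⟨ step h ⟩
  (1 + 2 * suc h) * suc h                              ∎
  where
  step : ∀ h → (1 + 2 * h) * h + (1 + 2 * h) + (2 + 2 * h) ≡ (1 + 2 * suc h) * suc h
  step = solve-∀

[1+a]^n-expansion : ∀ a n → ∃ λ c → (1 + a) ^ n ≡ 1 + n * a + triangular n * (a * a) + a * a * a * c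
[1+a]^n-expansion a zero = 0 , base a
  where
  base : ∀ a → 1 ≡ 1 + 0 * a + 0 * (a * a) + a * a * a * 0
  base = solve-∀
[1+a]^n-expansion a (suc n) with [1+a]^n-expansion a n
... | c , eq = c + triangular n + a * c , (begin
  (1 + a) * (1 + a) ^ n
    ≡⟨ cong ((1 + a) *_) eq ⟩
  (1 + a) * (1 + n * a + triangular n * (a * a) + a * a * a * c)
    ≡⟨ step a n (triangular n) c ⟩
  1 + suc n * a + (triangular n + n) * (a * a) + a * a * a * (c + triangular n + a * c) ∎)
  where
  step : ∀ a n T c → (1 + a) * (1 + n * a + T * (a * a) + a * a * a * c)
                     ≡ 1 + suc n * a + (T + n) * (a * a) + a * a * a * (c + T + a * c)
  step = solve-∀

-- Oddness of n is what makes the binomial coefficient n (n − 1) / 2 a multiple of n.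
[1+zn]^n-expansion : ∀ {n} h → n ≡ 1 + 2 * h → ∀ z →
                     ∃ λ t → (1 + z * n) ^ n ≡ 1 + n * (z * n * (1 + n * t))
[1+zn]^n-expansion h refl z with [1+a]^n-expansion (z * (1 + 2 * h)) (1 + 2 * h)
... | c , eq = h * z + z * z * c , (begin
  (1 + a) ^ n                                                 ≡⟨ eq ⟩
  1 + n * a + triangular n * (a * a) + a * a * a * c          ≡⟨ cong (λ T → 1 + n * a + T * (a * a) + a * a * a * c) (triangular-odd h) ⟩
  1 + n * a + n * h * (a * a) + a * a * a * c                 ≡⟨ regroup n h z c ⟩
  1 + n * (a * (1 + n * (h * z + z * z * c)))                 ∎)
  where
  n = 1 + 2 * h
  a = z * n
  regroup : ∀ n h z c → 1 + n * (z * n) + n * h * (z * n * (z * n)) + z * n * (z * n) * (z * n) * c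
                        ≡ 1 + n * (z * n * (1 + n * (h * z + z * z * c)))
  regroup = solve-∀

m∣m^n : ∀ {m n} → n ≢ 0 → m ∣ m ^ n
m∣m^n {n = zero}  n≢0 = contradiction refl n≢0
m∣m^n {m} {suc n} _   = m∣m*n (m ^ n)

q^e≡1+[q^e∸1] : ∀ q .{{_ : NonZero q}} e → q ^ e ≡ 1 + (q ^ e ∸ 1)
q^e≡1+[q^e∸1] q e = sym (m+[n∸m]≡n (m^n>0 q e))

p∤q⇒p∤q^a : ∀ {p q} → Prime p → p ∤ q → ∀ a → p ∤ q ^ a
p∤q⇒p∤q^a pr p∤q zero = p∤1 pr
p∤q⇒p∤q^a {q = q} pr p∤q (suc a) p∣q^[1+a] with euclidsLemma q (q ^ a) pr p∣q^[1+a]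
... | inj₁ p∣q   = p∤q p∣q
... | inj₂ p∣q^a = p∤q⇒p∤q^a pr p∤q a p∣q^a

p^m∣a*u⇒p^m∣a : ∀ {p u} → Prime p → p ∤ u → ∀ m {a} → p ^ m ∣ a * u → p ^ m ∣ a
p^m∣a*u⇒p^m∣a pr p∤u zero _ = 1∣ _
p^m∣a*u⇒p^m∣a {p} {u} pr p∤u (suc m) {a} p^[1+m]∣a*u
  with euclidsLemma a u pr (∣-trans (m∣m*n (p ^ m)) p^[1+m]∣a*u)
... | inj₂ p∣u = contradiction p∣u p∤u
... | inj₁ (divides b refl) = subst (_∣ b * p) (*-comm (p ^ m) p) (*-monoˡ-∣ p p^m∣b)
  where
  instance _ = prime⇒nonZero pr
  regroup : ∀ b p u → b * p * u ≡ p * (b * u)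
  regroup = solve-∀
  p^m∣b : p ^ m ∣ b
  p^m∣b = p^m∣a*u⇒p^m∣a pr p∤u m (*-cancelˡ-∣ p (subst (p * p ^ m ∣_) (regroup b p u) p^[1+m]∣a*u))

-- By Fermat c^(p−1) ≡ 1, so j = s · c^(p−2) · (p − 1) gives s + c j ≡ s p ≡ 0.
p∤c⇒∃[j]p∣s+c*j : ∀ {p c} → Prime p → p ∤ c → ∀ s → ∃ λ j → p ∣ s + c * j
p∤c⇒∃[j]p∣s+c*j {p@(suc (suc m))} {c} pr p∤c s with fermat pr c
... | f , c^p≡ = s * c ^ m * suc m , subst (p ∣_) (sym s+c*j≡) (∣m∣n⇒∣m+n (n∣m*n s) (∣m⇒∣m*n _ p∣e))
  where
  instance
    _ : NonZero c
    _ = ≢-nonZero λ c≡0 → p∤c (subst (p ∣_) (sym c≡0) (p ∣0))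
  e = c ^ suc m ∸ 1
  c*e≡p*f : c * e ≡ p * f
  c*e≡p*f = +-cancelˡ-≡ c (c * e) (p * f) (begin
    c + c * e        ≡⟨ *-suc c e ⟨
    c * (1 + e)      ≡⟨ cong (c *_) (q^e≡1+[q^e∸1] c (suc m)) ⟨
    c ^ p            ≡⟨ c^p≡ ⟩
    c + p * f        ∎)
  p∣e : p ∣ e
  p∣e with euclidsLemma c e pr (divides f (trans c*e≡p*f (*-comm p f)))
  ... | inj₁ p∣c = contradiction p∣c p∤c
  ... | inj₂ p∣e = p∣e
  s+c*j≡ : s + c * (s * c ^ m * suc m) ≡ s * p + e * (s * suc m)
  s+c*j≡ = begin
    s + c * (s * c ^ m * suc m)   ≡⟨ regroup₁ s c (c ^ m) m ⟩
    s + c * c ^ m * (s * suc m)   ≡⟨ cong (λ v → s + v * (s * suc m)) (q^e≡1+[q^e∸1] c (suc m)) ⟩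
    s + (1 + e) * (s * suc m)     ≡⟨ regroup₂ s e m ⟩
    s * p + e * (s * suc m)       ∎
    where
    regroup₁ : ∀ s c d m → s + c * (s * d * suc m) ≡ s + c * d * (s * suc m)
    regroup₁ = solve-∀
    regroup₂ : ∀ s e m → s + (1 + e) * (s * suc m) ≡ s * (2 + m) + e * (s * suc m)
    regroup₂ = solve-∀

-- Modulo A², y (1 + u A)^j + R ≡ A ((y + R) / A + j y u); choose j to make the bracket divisible by p.
lift-sum : ∀ {p A y u R} → Prime p → p ∣ A → p ∤ y * u → A ∣ y + R →
           ∃ λ j → A * p ∣ y * (1 + u * A) ^ j + R
lift-sum {p} {A} {y} {u} {R} pr p∣A p∤y*u (divides s y+R≡s*A)
  with p∤c⇒∃[j]p∣s+c*j pr p∤y*u s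
... | j , divides g s+y*u*j≡g*p with [1+a]^n-expansion (u * A) j
... | c , expand = j , subst (A * p ∣_) (sym sum≡)
                         (∣m∣n⇒∣m+n (*-monoʳ-∣ A (n∣m*n g)) (∣m⇒∣m*n W (*-monoʳ-∣ A p∣A)))
  where
  a = u * A
  W = u * u * (y * (triangular j + a * c))
  sum≡ : y * (1 + a) ^ j + R ≡ A * (g * p) + A * A * W
  sum≡ = begin
    y * (1 + a) ^ j + R                                                  ≡⟨ cong (λ v → y * v + R) expand ⟩
    y * (1 + j * a + triangular j * (a * a) + a * a * a * c) + R         ≡⟨ regroup₁ y R a j (triangular j) c ⟩
    (y + R) + a * (y * j) + a * a * (y * (triangular j + a * c))         ≡⟨ regroup₂ (y + R) u A y j (y * (triangular j + a * c)) ⟩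
    (y + R) + A * (y * u * j) + A * A * W                                ≡⟨ cong (λ v → v + A * (y * u * j) + A * A * W) y+R≡s*A ⟩
    s * A + A * (y * u * j) + A * A * W                                  ≡⟨ cong (_+ A * A * W) (trans (cong (_+ A * (y * u * j)) (*-comm s A)) (sym (*-distribˡ-+ A s (y * u * j)))) ⟩
    A * (s + y * u * j) + A * A * W                                      ≡⟨ cong (λ v → A * v + A * A * W) s+y*u*j≡g*p ⟩
    A * (g * p) + A * A * W                                              ∎
    where
    regroup₁ : ∀ y R a j T c → y * (1 + j * a + T * (a * a) + a * a * a * c) + R
                               ≡ (y + R) + a * (y * j) + a * a * (y * (T + a * c))
    regroup₁ = solve-∀
    regroup₂ : ∀ S u A y j Z → S + u * A * (y * j) + u * A * (u * A) * Z
                               ≡ S + A * (y * u * j) + A * A * (u * u * Z)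
    regroup₂ = solve-∀

sumRep-∣ : ∀ {d e q t} → d ∣ e → SumRep e q t → SumRep d q t
sumRep-∣ d∣e (as , len , e∣Σ) = as , len , ∣-trans d∣e e∣Σ

sumRep-lift : ∀ {p q r u A t} → Prime p → p ∣ A → p ∤ q → p ∤ u → q ^ r ≡ 1 + u * A →
              SumRep A q t → SumRep (A * p) q t
sumRep-lift pr p∣A p∤q p∤u q^r≡1+u*A ([] , len , _) = [] , len , _ ∣0
sumRep-lift {p} {q} {r} {u} {A} {t} pr p∣A p∤q p∤u q^r≡1+u*A ((a ∷ as) , len , A∣Σ) =
  extend (lift-sum {y = q ^ a} {u = u} {R = sumˡ (map (q ^_) as)} pr p∣A p∤q^a*u A∣Σ)
  where
  p∤q^a*u : p ∤ q ^ a * u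
  p∤q^a*u p∣q^a*u with euclidsLemma (q ^ a) u pr p∣q^a*u
  ... | inj₁ p∣q^a = p∤q⇒p∤q^a pr p∤q a p∣q^a
  ... | inj₂ p∣u   = p∤u p∣u
  extend : (∃ λ j → A * p ∣ q ^ a * (1 + u * A) ^ j + sumˡ (map (q ^_) as)) → SumRep (A * p) q t
  extend (j , A*p∣Σ′) = (a + r * j ∷ as) , len , subst (A * p ∣_) (cong (_+ sumˡ (map (q ^_) as)) (sym q^[a+r*j]≡)) A*p∣Σ′
    where
    q^[a+r*j]≡ : q ^ (a + r * j) ≡ q ^ a * (1 + u * A) ^ j
    q^[a+r*j]≡ = begin
      q ^ (a + r * j)          ≡⟨ ^-distribˡ-+-* q a (r * j) ⟩
      q ^ a * q ^ (r * j)      ≡⟨ cong (q ^ a *_) (^-*-assoc q r j) ⟨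
      q ^ a * (q ^ r) ^ j      ≡⟨ cong (λ v → q ^ a * v ^ j) q^r≡1+u*A ⟩
      q ^ a * (1 + u * A) ^ j  ∎

module OddPrime {p h : ℕ} (p≡1+2h : p ≡ 1 + 2 * h) (pr : Prime p) where

  instance _ = prime⇒nonZero pr

  p∤1+p*t : ∀ t → p ∤ 1 + p * t
  p∤1+p*t t p∣1+p*t = p∤1 pr (∣m+n∣m⇒∣n (subst (p ∣_) (+-comm 1 (p * t)) p∣1+p*t) (m∣m*n t))

  lifting-the-exponent : ∀ m {y} → p ∣ y → p ^ suc m ∣ (1 + y) ^ p ∸ 1 ⇔ p ^ m ∣ y
  lifting-the-exponent m (divides z refl) with [1+zn]^n-expansion h p≡1+2h z
  ... | t , expand = mk⇔
    (λ p^[1+m]∣ → p^m∣a*u⇒p^m∣a pr (p∤1+p*t t) m (*-cancelˡ-∣ p (subst (p ^ suc m ∣_) [1+y]^p∸1≡ p^[1+m]∣)))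
    (λ p^m∣y → subst (p ^ suc m ∣_) (sym [1+y]^p∸1≡) (*-monoʳ-∣ p (∣m⇒∣m*n (1 + p * t) p^m∣y)))
    where
    [1+y]^p∸1≡ : (1 + z * p) ^ p ∸ 1 ≡ p * (z * p * (1 + p * t))
    [1+y]^p∸1≡ = cong (_∸ 1) expand

  module Descent (q k r : ℕ) .{{_ : NonZero q}} (p∤q : p ∤ q) (ord : IsOrd (p ^ suc k) q (r * p)) where

    [1+[q^e∸1]]^p≡q^[e*p] : ∀ e → (1 + (q ^ e ∸ 1)) ^ p ≡ q ^ (e * p)
    [1+[q^e∸1]]^p≡q^[e*p] e = trans (cong (_^ p) (sym (q^e≡1+[q^e∸1] q e))) (^-*-assoc q e p)

    0<r : 0 < r
    0<r = >-nonZero⁻¹ r {{m*n≢0⇒m≢0 r {{>-nonZero (proj₁ ord)}}}}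

    r<r*p : r < r * p
    r<r*p = m<m*n r p {{>-nonZero 0<r}} (nonTrivial⇒n>1 p {{prime⇒nonTrivial pr}})

    y : ℕ
    y = q ^ r ∸ 1

    p^[1+k]∣[1+y]^p∸1 : p ^ suc k ∣ (1 + y) ^ p ∸ 1
    p^[1+k]∣[1+y]^p∸1 = subst (λ v → p ^ suc k ∣ v ∸ 1) (sym ([1+[q^e∸1]]^p≡q^[e*p] r)) (proj₁ (proj₂ ord))

    p∣y : p ∣ y
    p∣y with fermat pr (1 + y)
    ... | c , [1+y]^p≡ = ∣m+n∣m⇒∣n (subst (p ∣_) (+-comm y (p * c)) p∣y+p*c) (m∣m*n c)
      where
      p∣y+p*c : p ∣ y + p * c
      p∣y+p*c = subst (p ∣_) (cong (_∸ 1) [1+y]^p≡) (∣-trans (m∣m*n (p ^ k)) p^[1+k]∣[1+y]^p∸1)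

    p^k∣y : p ^ k ∣ y
    p^k∣y = Equivalence.to (lifting-the-exponent k p∣y) p^[1+k]∣[1+y]^p∸1

    p^[1+k]∤y : p ^ suc k ∤ y
    p^[1+k]∤y p^[1+k]∣y = <⇒≱ r<r*p (proj₂ (proj₂ ord) r 0<r p^[1+k]∣y)

    k≢0 : k ≢ 0
    k≢0 k≡0 = p^[1+k]∤y (subst (λ k → p ^ suc k ∣ y) (sym k≡0) (subst (_∣ y) (sym (*-identityʳ p)) p∣y))

    p∣p^k : p ∣ p ^ k
    p∣p^k = m∣m^n k≢0

    r-minimal : ∀ n → 0 < n → p ^ k ∣ q ^ n ∸ 1 → r ≤ n
    r-minimal n 0<n p^k∣q^n∸1 = *-cancelʳ-≤ r n p (proj₂ (proj₂ ord) (n * p) 0<n*p p^[1+k]∣q^[n*p]∸1)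
      where
      0<n*p : 0 < n * p
      0<n*p = >-nonZero⁻¹ (n * p) {{m*n≢0 n p {{>-nonZero 0<n}}}}
      p^[1+k]∣q^[n*p]∸1 : p ^ suc k ∣ q ^ (n * p) ∸ 1
      p^[1+k]∣q^[n*p]∸1 = subst (λ v → p ^ suc k ∣ v ∸ 1) ([1+[q^e∸1]]^p≡q^[e*p] n)
        (Equivalence.from (lifting-the-exponent k (∣-trans p∣p^k p^k∣q^n∸1)) p^k∣q^n∸1)

    ord-descends : IsOrd (p ^ k) q r
    ord-descends = 0<r , p^k∣y , r-minimal

    u : ℕ
    u = quotient p^k∣y

    y≡u*p^k : y ≡ u * p ^ k
    y≡u*p^k = m∣n⇒n≡quotient*m p^k∣y

    p∤u : p ∤ u
    p∤u p∣u = p^[1+k]∤y (subst (p ^ suc k ∣_) (sym y≡u*p^k) (*-monoˡ-∣ (p ^ k) p∣u))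

    q^r≡1+u*p^k : q ^ r ≡ 1 + u * p ^ k
    q^r≡1+u*p^k = trans (q^e≡1+[q^e∸1] q r) (cong (1 +_) y≡u*p^k)

    sumRep-ascends : ∀ {t} → SumRep (p ^ k) q t → SumRep (p ^ suc k) q t
    sumRep-ascends {t} rep = subst (λ B → SumRep B q t) (*-comm (p ^ k) p) (sumRep-lift {r = r} pr p∣p^k p∤q p∤u q^r≡1+u*p^k rep)

    m-descends : ∀ t → IsM (p ^ suc k) q t ⇔ IsM (p ^ k) q t
    m-descends t = mk⇔
      (λ (0<t , rep , least) → 0<t , sumRep-∣ (n∣m*n p) rep , λ t′ 0<t′ rep′ → least t′ 0<t′ (sumRep-ascends rep′))
      (λ (0<t , rep , least) → 0<t , sumRep-ascends rep , λ t′ 0<t′ rep′ → least t′ 0<t′ (sumRep-∣ (n∣m*n p) rep′))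

proposition9 : (p k q i d : ℕ) → Prime p → p ≢ 2 → 0 < k → 0 < q → ¬ (p ∣ q)
    → IsOrd (p ^ k) q (p ^ i * d) → d ∣ (p ∸ 1) → 0 < i
    → IsOrd (p ^ (k ∸ 1)) q (p ^ (i ∸ 1) * d)
    × (∀ t → IsM (p ^ k) q t ⇔ IsM (p ^ (k ∸ 1)) q t)
proposition9 p (suc k) q (suc i) d pr p≢2 _ 0<q p∤q ord _ _ with prime≢2⇒odd pr p≢2
... | h , p≡1+2h = ord-descends , m-descends
  where
  instance _ = >-nonZero 0<q
  regroup : ∀ p a d → p * a * d ≡ a * d * p
  regroup = solve-∀
  open OddPrime.Descent {h = h} p≡1+2h pr q k (p ^ i * d) p∤q (subst (IsOrd _ q) (regroup p (p ^ i) d) ord)
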